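{- Let $f:\mathfrak A\to\mathfrak B$ be a partial team map between $\tau$-structures. The following are equivalent: (1) $f$ is a partial elementary team map; (2) for every first-order sentence $\phi(R_0,\dots,R_{n-1})$ with free second-order relation variables $R_i$, and every choice of nonempty $X_i\in\mathrm{dom}(f)$ of arity $\mathrm{ar}(R_i)$ ($i<n$), $\mathfrak A\models\phi(X_0,\dots,X_{n-1})$ iff $\mathfrak B\models\phi(f(X_0),\dots,f(X_{n-1}))$; (3) letting $\underline X$ be a new $n$-ary relation symbol for each $n$-ary $X\in\mathrm{dom}(f)$ and $\tau'=\tau\cup\{\underline X:X\in\mathrm{dom}(f)\}$, the partial function $a\mapsto f(a)$ (defined for $\{a\}\in\mathrm{dom}(f)$) is a partial elementary map between the $\tau'$-structures $\hat{\mathfrak A}$ and $\hat{\mathfrak B}$, where $\hat{\mathfrak A}\restriction\tau=\mathfrak A$, $\hat{\mathfrak B}\restriction\tau=\mathfrak B$, $\underline X^{\hat{\mathfrak A}}=X$ and $\underline X^{\hat{\mathfrak B}}=f(X)$.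
   Context: For a structure $\mathfrak A$, $\mathcal R(\mathfrak A)=\bigcup_n\mathcal P(\mathfrak A^n)$. A partial team map $f:\mathfrak A\to\mathfrak B$ is an arity-preserving partial function $\mathcal R(\mathfrak A)\to\mathcal R(\mathfrak B)$ whose domain and range are closed (contain $\emptyset$, all powers, the diagonal, interpretations of symbols (graphs for functions, $\{c\}$ for constants), and are closed under $\cap$, Cartesian product $\times$ by concatenation, and coordinate maps $\mathrm{Pr}_{\vec\imath}(X)=\{(a_{i_0},\dots,a_{i_{m-1}}):\vec a\in X\}$). If $\{a\}\in\mathrm{dom}(f)$ and $f(\{a\})$ is a singleton, $f(a)$ denotes its element. $f$ is a partial elementary team map if $f(X\times Y)=f(X)\times f(Y)$ for $X,Y\in\mathrm{dom}(f)$ and for every formula $\phi(v_0,\dots,v_{n-1})$ of $\mathrm{FOT}$ and $n$-ary $X\in\mathrm{dom}(f)$, $\mathfrak A\models_X\phi$ iff $\mathfrak B\models_{f(X)}\phi$, identifying $X$ with the team $\{\{(v_i,a_i):i<n\}:\vec a\in X\}$. $\mathrm{FOT}$: first-order atoms (true in a team iff at every assignment), inclusion atoms $\vec x\subseteq\vec y$ ($X[\vec x]\subseteq X[\vec y]$), constancy atoms ${=}(\vec x)$ ($|X[\vec x]|\le1$), weak classical negation ${\sim}\phi$ ($X=\emptyset$ or $\phi$ fails), classical conjunction and disjunction, and $\exists^1x,\forall^1x$ (substituting some/every single element for $x$ in all assignments). A partial elementary map $g$ between structures is a partial function preserving all first-order formulas with parameters from $\mathrm{dom}(g)$ in both directions.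 -}

module Defs where

open import Level using (Level; Lift; lift; lower) renaming (zero to lzero; suc to lsuc)
open import Data.Nat using (ℕ; zero; suc; _+_)
open import Data.Fin using (Fin)
open import Data.Vec using (Vec; []; _∷_; lookup; map; take; drop; head; tail)
open import Data.Vec.Relation.Binary.Pointwise.Inductive using (Pointwise)
open import Data.Product using (Σ; Σ-syntax; _×_; _,_; proj₁)
open import Data.Sum using (_⊎_; inj₁; inj₂)
open import Data.Empty using (⊥)
open import Data.Unit using (⊤)
open import Relation.Nullary using (¬_)
open import Relation.Binary.PropositionalEquality using (_≡_)
open import Axiom.ExcludedMiddle using (ExcludedMiddle) public

record Sig : Set₂ where
  field
    RelSym : Set₁
    rar    : RelSym → ℕ
    FunSym : Set₁
    far    : FunSym → ℕ
    ConSym : Set₁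
open Sig public

record Structure (τ : Sig) : Set₂ where
  field
    Carrier : Set
    relI    : (r : RelSym τ) → Vec Carrier (rar τ r) → Set
    funI    : (g : FunSym τ) → Vec Carrier (far τ g) → Carrier
    conI    : ConSym τ → Carrier
open Structure public

RelOn : Set → ℕ → Set₁
RelOn C n = Vec C n → Set

_≐_ : {C : Set} {n : ℕ} → RelOn C n → RelOn C n → Set
X ≐ Y = ∀ v → (X v → Y v) × (Y v → X v)

∅ᴿ : {C : Set} (n : ℕ) → RelOn C n
∅ᴿ n _ = ⊥

fullᴿ : {C : Set} (n : ℕ) → RelOn C n
fullᴿ n _ = ⊤

diagᴿ : {C : Set} → RelOn C 2
diagᴿ (a ∷ b ∷ []) = a ≡ b

singᴿ : {C : Set} → C → RelOn C 1
singᴿ a v = v ≡ a ∷ []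

_∩ᴿ_ : {C : Set} {n : ℕ} → RelOn C n → RelOn C n → RelOn C n
(X ∩ᴿ Y) v = X v × Y v

_⊗_ : {C : Set} {m k : ℕ} → RelOn C m → RelOn C k → RelOn C (m + k)
_⊗_ {m = m} X Y v = X (take m v) × Y (drop m v)

Pr : {C : Set} {n m : ℕ} → Vec (Fin n) m → RelOn C n → RelOn C m
Pr {C} {n} is X w = Σ[ v ∈ Vec C n ] (X v × map (lookup v) is ≡ w)

graphᴿ : {τ : Sig} (A : Structure τ) (g : FunSym τ) → RelOn (Carrier A) (far τ g + 1)
graphᴿ {τ} A g v = funI A g (take (far τ g) v) ≡ head (drop (far τ g) v)

record Closed {τ : Sig} (A : Structure τ) (P : (n : ℕ) → RelOn (Carrier A) n → Set₁) : Set₁ where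
  field
    c-empty : ∀ n → P n (∅ᴿ n)
    c-full  : ∀ n → P n (fullᴿ n)
    c-diag  : P 2 diagᴿ
    c-rel   : ∀ r → P (rar τ r) (relI A r)
    c-fun   : ∀ g → P (far τ g + 1) (graphᴿ A g)
    c-con   : ∀ c → P 1 (singᴿ (conI A c))
    c-inter : ∀ n X Y → P n X → P n Y → P n (X ∩ᴿ Y)
    c-prod  : ∀ m k (X : RelOn (Carrier A) m) (Y : RelOn (Carrier A) k) → P m X → P k Y → P (m + k) (X ⊗ Y)
    c-proj  : ∀ n m (is : Vec (Fin n) m) X → P n X → P m (Pr is X)

record PartialTeamMap {τ : Sig} (A B : Structure τ) : Set₂ where
  field
    Dom    : (n : ℕ) → RelOn (Carrier A) n → Set₁
    app    : (n : ℕ) (X : RelOn (Carrier A) n) → Dom n X → RelOn (Carrier B) n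
    -- well-definedness w.r.t. extensional equality of sets
    Dom-ext : ∀ n X Y → X ≐ Y → Dom n X → Dom n Y
    app-wd  : ∀ n X Y (p : Dom n X) (q : Dom n Y) → X ≐ Y → app n X p ≐ app n Y q
  Rng : (n : ℕ) → RelOn (Carrier B) n → Set₁
  Rng n Y = Σ[ X ∈ RelOn (Carrier A) n ] Σ[ p ∈ Dom n X ] (app n X p ≐ Y)
  field
    dom-closed : Closed A Dom
    rng-closed : Closed B Rng
open PartialTeamMap public

data Term (τ : Sig) (n : ℕ) : Set₁ where
  var : Fin n → Term τ n
  con : ConSym τ → Term τ n
  fapp : (g : FunSym τ) → Vec (Term τ n) (far τ g) → Term τ n

module _ {τ : Sig} (A : Structure τ) where
  mutual
    evalT : {n : ℕ} → Term τ n → Vec (Carrier A) n → Carrier A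
    evalT (var i) s = lookup s i
    evalT (con c) s = conI A c
    evalT (fapp g ts) s = funI A g (evalTs ts s)

    evalTs : {n k : ℕ} → Vec (Term τ n) k → Vec (Carrier A) n → Vec (Carrier A) k
    evalTs [] s = []
    evalTs (t ∷ ts) s = evalT t s ∷ evalTs ts s

data FO (τ : Sig) : ℕ → Set₁ where
  rel  : {n : ℕ} (r : RelSym τ) → Vec (Term τ n) (rar τ r) → FO τ n
  eq   : {n : ℕ} → Term τ n → Term τ n → FO τ n
  neg  : {n : ℕ} → FO τ n → FO τ n
  conj : {n : ℕ} → FO τ n → FO τ n → FO τ n
  disj : {n : ℕ} → FO τ n → FO τ n → FO τ n
  all  : {n : ℕ} → FO τ (suc n) → FO τ n
  ex   : {n : ℕ} → FO τ (suc n) → FO τ n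

Sat : {τ : Sig} (A : Structure τ) {n : ℕ} → FO τ n → Vec (Carrier A) n → Set
Sat A (rel r ts) s = relI A r (evalTs A ts s)
Sat A (eq t u) s = evalT A t s ≡ evalT A u s
Sat A (neg φ) s = ¬ Sat A φ s
Sat A (conj φ ψ) s = Sat A φ s × Sat A ψ s
Sat A (disj φ ψ) s = Sat A φ s ⊎ Sat A ψ s
Sat A (all φ) s = ∀ a → Sat A φ (a ∷ s)
Sat A (ex φ) s = Σ[ a ∈ Carrier A ] Sat A φ (a ∷ s)

-- FOT syntax and team semantics; a team over v_0..v_{n-1} is an n-ary relation

data FOT (τ : Sig) : ℕ → Set₁ where
  atRel  : {n : ℕ} (r : RelSym τ) → Vec (Term τ n) (rar τ r) → FOT τ n
  atEq   : {n : ℕ} → Term τ n → Term τ n → FOT τ n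
  incl   : {n m : ℕ} → Vec (Fin n) m → Vec (Fin n) m → FOT τ n
  const  : {n m : ℕ} → Vec (Fin n) m → FOT τ n
  wneg   : {n : ℕ} → FOT τ n → FOT τ n
  cconj  : {n : ℕ} → FOT τ n → FOT τ n → FOT τ n
  cdisj  : {n : ℕ} → FOT τ n → FOT τ n → FOT τ n
  ex1    : {n : ℕ} → FOT τ (suc n) → FOT τ n
  all1   : {n : ℕ} → FOT τ (suc n) → FOT τ n

extTeam : {C : Set} {n : ℕ} → RelOn C n → C → RelOn C (suc n)
extTeam X a t = X (tail t) × head t ≡ a

TSat : {τ : Sig} (A : Structure τ) {n : ℕ} → RelOn (Carrier A) n → FOT τ n → Set
TSat A X (atRel r ts) = ∀ s → X s → relI A r (evalTs A ts s)
TSat A X (atEq t u) = ∀ s → X s → evalT A t s ≡ evalT A u s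
TSat A X (incl xs ys) = ∀ s → X s → Σ[ s' ∈ _ ] (X s' × map (lookup s) xs ≡ map (lookup s') ys)
TSat A X (const xs) = ∀ s s' → X s → X s' → map (lookup s) xs ≡ map (lookup s') xs
TSat A X (wneg φ) = (∀ s → ¬ X s) ⊎ ¬ TSat A X φ
TSat A X (cconj φ ψ) = TSat A X φ × TSat A X ψ
TSat A X (cdisj φ ψ) = TSat A X φ ⊎ TSat A X ψ
TSat A X (ex1 φ) = Σ[ a ∈ Carrier A ] TSat A (extTeam X a) φ
TSat A X (all1 φ) = ∀ a → TSat A (extTeam X a) φ

_⇔_ : {ℓ ℓ' : Level} → Set ℓ → Set ℓ' → Set (ℓ Level.⊔ ℓ')
P ⇔ Q = (P → Q) × (Q → P)

expandSig : (τ : Sig) (E : Set₁) → (E → ℕ) → Sig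
expandSig τ E ear = record
  { RelSym = RelSym τ ⊎ E
  ; rar = λ { (inj₁ r) → rar τ r ; (inj₂ e) → ear e }
  ; FunSym = FunSym τ ; far = far τ ; ConSym = ConSym τ }

expandStr : {τ : Sig} (A : Structure τ) (E : Set₁) (ear : E → ℕ)
          → ((e : E) → RelOn (Carrier A) (ear e)) → Structure (expandSig τ E ear)
expandStr A E ear I = record
  { Carrier = Carrier A
  ; relI = λ { (inj₁ r) → relI A r ; (inj₂ e) → I e }
  ; funI = funI A ; conI = conI A }

module _ {τ : Sig} {A B : Structure τ} (f : PartialTeamMap A B) where

  IsElementaryTeamMap : Set₁
  IsElementaryTeamMap =
    (∀ m k (X : RelOn (Carrier A) m) (Y : RelOn (Carrier A) k)
       (p : Dom f m X) (q : Dom f k Y) (r : Dom f (m + k) (X ⊗ Y))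
       → app f (m + k) (X ⊗ Y) r ≐ (app f m X p ⊗ app f k Y q))
    × (∀ n (φ : FOT τ n) (X : RelOn (Carrier A) n) (p : Dom f n X)
         → TSat A X φ ⇔ TSat B (app f n X p) φ)

  PreservesSOParams : Set₁
  PreservesSOParams =
    ∀ (n : ℕ) (ar : Fin n → ℕ)
      (φ : FO (expandSig τ (Lift (lsuc lzero) (Fin n)) (λ i → ar (lower i))) 0)
      (X : (i : Fin n) → RelOn (Carrier A) (ar i))
      (p : (i : Fin n) → Dom f (ar i) (X i))
      → (∀ i → Σ[ v ∈ Vec (Carrier A) (ar i) ] X i v)
      → Sat (expandStr A _ _ (λ i → X (lower i))) φ []
        ⇔ Sat (expandStr B _ _ (λ i → app f (ar (lower i)) (X (lower i)) (p (lower i)))) φ []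

  DomSym : Set₁
  DomSym = Σ[ n ∈ ℕ ] Σ[ X ∈ RelOn (Carrier A) n ] Dom f n X

  Â : Structure (expandSig τ DomSym proj₁)
  Â = expandStr A DomSym proj₁ (λ { (n , X , p) → X })

  B̂ : Structure (expandSig τ DomSym proj₁)
  B̂ = expandStr B DomSym proj₁ (λ { (n , X , p) → app f n X p })

  PointMap : Carrier A → Carrier B → Set₁
  PointMap a b = Σ[ p ∈ Dom f 1 (singᴿ a) ] (app f 1 (singᴿ a) p ≐ singᴿ b)

  InducedIsPartialElementary : Set₁
  InducedIsPartialElementary =
    ∀ (k : ℕ) (φ : FO (expandSig τ DomSym proj₁) k)
      (as : Vec (Carrier A) k) (bs : Vec (Carrier B) k)
      → Pointwise PointMap as bs
      → Sat Â φ as ⇔ Sat B̂ φ bs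

{-# OPTIONS --safe #-}
-- (1) ⇒ (3): a formula φ of the expanded signature, with parameters X₁, …, Xₙ ∈ dom(f), is evaluated
-- on the team {a⃗} × X₁ × ⋯ × Xₙ. Its quantifiers become ∃¹ and ∀¹, and an atom X̲ᵢ(t⃗) says that some
-- tuple z⃗ equals t⃗ and is included in the i-th block of the team. Since f commutes with products and
-- sends {a} to {f(a)}, the image of this team is {f(a⃗)} × f(X₁) × ⋯ × f(Xₙ), so FOT-elementarity
-- transfers φ. An empty parameter would empty the whole team; but ∼(() ⊆ ()) defines emptiness, so f
-- preserves it and the atoms of empty parameters can be replaced by falsity.
-- (3) ⇒ (2) is the special case of sentences.
-- (2) ⇒ (1): on a team X, FOT is first-order logic with X as a relation parameter, and Z = X × Y is a
-- first-order sentence in the parameters X, Y, Z. Parameters must be nonempty, so empty teams are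
-- treated apart: ∅ = f(W) forces W = ∅ and thus f(∅) = ∅, and on the empty team an FOT formula only
-- depends on whether the carrier is nonempty, which (2) transfers through ∃x x = x.
module Submission where

open import Defs
open import Level using (Level; Lift; lift; lower) renaming (zero to lzero; suc to lsuc)
open import Function using (_∘_; id)
open import Data.Nat using (ℕ; zero; suc; _+_)
open import Data.Fin using (Fin; zero; suc; _↑ˡ_; _↑ʳ_; splitAt)
open import Data.Vec using (Vec; []; _∷_; lookup; map; take; drop; _++_; allFin)
open import Data.Vec.Properties
  using ( lookup-++ˡ; lookup-++ʳ; lookup-splitAt; map-∘; map-cong; map-lookup-allFin
        ; take-map; drop-map; take++drop≡id; ∷-injective)
open import Data.Vec.Relation.Binary.Pointwise.Inductive using (Pointwise; []; _∷_)
open import Data.Product using (_×_; Σ; Σ-syntax; _,_; proj₁; proj₂)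
open import Data.Sum using (_⊎_; inj₁; inj₂; [_,_]′)
open import Data.Sum.Properties using ([,]-∘; [,]-cong)
open import Data.Empty using (⊥; ⊥-elim)
open import Data.Unit using (tt)
open import Data.Bool using (Bool; true; false)
open import Relation.Nullary using (¬_; Dec; yes; no)
open import Relation.Binary.PropositionalEquality
  using (_≡_; refl; sym; trans; cong; cong₂; subst; module ≡-Reasoning)

private
  variable
    a b ℓ : Level
    P P′ Q Q′ R : Set ℓ
    C : Set
    k m n N : ℕ

⇔-refl : P ⇔ P
⇔-refl = id , id

⇔-sym : P ⇔ Q → Q ⇔ P
⇔-sym (to , from) = from , to

⇔-trans : P ⇔ Q → Q ⇔ R → P ⇔ R
⇔-trans (to , from) (to′ , from′) = to′ ∘ to , from ∘ from′

module ⇔-Reasoning where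
  infix  1 begin_
  infixr 2 _⇔⟨_⟩_ _⇔˘⟨_⟩_
  infix  3 _∎

  begin_ : P ⇔ Q → P ⇔ Q
  begin_ = id

  _⇔⟨_⟩_ : (P : Set a) → P ⇔ Q → Q ⇔ R → P ⇔ R
  _ ⇔⟨ p ⟩ q = ⇔-trans p q

  _⇔˘⟨_⟩_ : (P : Set a) → Q ⇔ P → Q ⇔ R → P ⇔ R
  _ ⇔˘⟨ p ⟩ q = ⇔-trans (⇔-sym p) q

  _∎ : (P : Set a) → P ⇔ P
  _ ∎ = ⇔-refl

_×-⇔_ : P ⇔ P′ → Q ⇔ Q′ → (P × Q) ⇔ (P′ × Q′)
(f , f′) ×-⇔ (g , g′) = (λ (p , q) → f p , g q) , (λ (p , q) → f′ p , g′ q)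

_⊎-⇔_ : P ⇔ P′ → Q ⇔ Q′ → (P ⊎ Q) ⇔ (P′ ⊎ Q′)
(f , f′) ⊎-⇔ (g , g′) = [ inj₁ ∘ f , inj₂ ∘ g ]′ , [ inj₁ ∘ f′ , inj₂ ∘ g′ ]′

→-⇔ : P ⇔ P′ → Q ⇔ Q′ → (P → Q) ⇔ (P′ → Q′)
→-⇔ (f , f′) (g , g′) = (λ h → g ∘ h ∘ f′) , (λ h → g′ ∘ h ∘ f)

⇔-⇔ : P ⇔ P′ → Q ⇔ Q′ → (P ⇔ Q) ⇔ (P′ ⇔ Q′)
⇔-⇔ e e′ = →-⇔ e e′ ×-⇔ →-⇔ e′ e

¬-⇔ : P ⇔ P′ → (¬ P) ⇔ (¬ P′)
¬-⇔ e = →-⇔ e ⇔-refl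

Π-⇔ : {A : Set a} {F G : A → Set b} → (∀ x → F x ⇔ G x) → (∀ x → F x) ⇔ (∀ x → G x)
Π-⇔ e = (λ h x → proj₁ (e x) (h x)) , (λ h x → proj₂ (e x) (h x))

Σ-⇔ : {A : Set a} {F G : A → Set b} → (∀ x → F x ⇔ G x) → Σ A F ⇔ Σ A G
Σ-⇔ e = (λ (x , y) → x , proj₁ (e x) y) , (λ (x , y) → x , proj₂ (e x) y)

subst-⇔ : {A : Set a} (F : A → Set b) {x y : A} → x ≡ y → F x ⇔ F y
subst-⇔ F x≡y = subst F x≡y , subst F (sym x≡y)

≡-⇔ : {A : Set a} {x x′ y y′ : A} → x ≡ x′ → y ≡ y′ → (x ≡ y) ⇔ (x′ ≡ y′)
≡-⇔ x≡x′ y≡y′ = (λ x≡y → trans (sym x≡x′) (trans x≡y y≡y′))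
              , (λ x′≡y′ → trans x≡x′ (trans x′≡y′ (sym y≡y′)))

sym-⇔ : {A : Set a} {x y : A} → (x ≡ y) ⇔ (y ≡ x)
sym-⇔ = sym , sym

one-point : {A : Set a} {F : A → Set b} {y : A} → (Σ[ x ∈ A ] (x ≡ y × F x)) ⇔ F y
one-point = (λ { (_ , refl , p) → p }) , (λ p → _ , refl , p)

decide : ExcludedMiddle (lsuc lzero) → (P : Set) → Dec P
decide lem P with lem {Lift (lsuc lzero) P}
... | yes (lift p) = yes p
... | no ¬p = no (¬p ∘ lift)

¬⊎⇔→ : Dec P → ((¬ P) ⊎ Q) ⇔ (P → Q)
¬⊎⇔→ P? = [ (λ ¬p p → ⊥-elim (¬p p)) , (λ q _ → q) ]′ , from P?
  where
  from : Dec P → (P → Q) → (¬ P) ⊎ Q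
  from (yes p) h = inj₂ (h p)
  from (no ¬p) _ = inj₁ ¬p

take-++ : (xs : Vec C m) (ys : Vec C n) → take m (xs ++ ys) ≡ xs
take-++ []       ys = refl
take-++ (x ∷ xs) ys = cong (x ∷_) (take-++ xs ys)

drop-++ : (xs : Vec C m) (ys : Vec C n) → drop m (xs ++ ys) ≡ ys
drop-++ []       ys = refl
drop-++ (x ∷ xs) ys = drop-++ xs ys

map-lookup-rename : {m₀ m₁ : ℕ} {ρ : Fin m₀ → Fin m₁} (s : Vec C m₀) (s′ : Vec C m₁)
                  → (∀ i → lookup s′ (ρ i) ≡ lookup s i) → (is : Vec (Fin m₀) k)
                  → map (lookup s′) (map ρ is) ≡ map (lookup s) is
map-lookup-rename {ρ = ρ} s s′ h is = trans (sym (map-∘ (lookup s′) ρ is)) (map-cong h is)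

map-lookup-↑ˡ : (xs : Vec C m) (ys : Vec C n) (is : Vec (Fin m) k)
              → map (lookup (xs ++ ys)) (map (_↑ˡ n) is) ≡ map (lookup xs) is
map-lookup-↑ˡ xs ys = map-lookup-rename xs (xs ++ ys) (lookup-++ˡ xs ys)

map-lookup-↑ʳ : (xs : Vec C m) (ys : Vec C n) (is : Vec (Fin n) k)
              → map (lookup (xs ++ ys)) (map (m ↑ʳ_) is) ≡ map (lookup ys) is
map-lookup-↑ʳ xs ys = map-lookup-rename ys (xs ++ ys) (lookup-++ʳ xs ys)

firsts : (m n : ℕ) → Vec (Fin (m + n)) m
firsts m n = map (_↑ˡ n) (allFin m)

lasts : (m n : ℕ) → Vec (Fin (m + n)) n
lasts m n = map (m ↑ʳ_) (allFin n)

map-lookup-firsts : (xs : Vec C m) (ys : Vec C n) → map (lookup (xs ++ ys)) (firsts m n) ≡ xs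
map-lookup-firsts xs ys = trans (map-lookup-↑ˡ xs ys _) (map-lookup-allFin xs)

map-lookup-lasts : (xs : Vec C m) (ys : Vec C n) → map (lookup (xs ++ ys)) (lasts m n) ≡ ys
map-lookup-lasts xs ys = trans (map-lookup-↑ʳ xs ys _) (map-lookup-allFin ys)

map-lookup-firsts-take : (v : Vec C (m + n)) → map (lookup v) (firsts m n) ≡ take m v
map-lookup-firsts-take {m = m} v =
  trans (cong (λ v′ → map (lookup v′) (firsts m _)) (sym (take++drop≡id m v)))
        (map-lookup-firsts (take m v) (drop m v))

map-lookup-lasts-drop : (v : Vec C (m + n)) → map (lookup v) (lasts m n) ≡ drop m v
map-lookup-lasts-drop {m = m} v =
  trans (cong (λ v′ → map (lookup v′) (lasts m _)) (sym (take++drop≡id m v)))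
        (map-lookup-lasts (take m v) (drop m v))

lookup-[,]∘splitAt : {N : ℕ} (S : Vec C N) {f : Fin k → Fin N} {g : Fin n → Fin N}
                     (xs : Vec C k) (ys : Vec C n)
                   → (∀ j → lookup S (f j) ≡ lookup xs j) → (∀ j → lookup S (g j) ≡ lookup ys j)
                   → ∀ i → lookup S ([ f , g ]′ (splitAt k i)) ≡ lookup (xs ++ ys) i
lookup-[,]∘splitAt {k = k} S {f} {g} xs ys hf hg i = begin
  lookup S ([ f , g ]′ (splitAt k i))              ≡⟨ [,]-∘ (lookup S) (splitAt k i) ⟩
  [ lookup S ∘ f , lookup S ∘ g ]′ (splitAt k i)  ≡⟨ [,]-cong hf hg (splitAt k i) ⟩
  [ lookup xs , lookup ys ]′ (splitAt k i)         ≡⟨ sym (lookup-splitAt k xs ys i) ⟩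
  lookup (xs ++ ys) i                              ∎
  where open ≡-Reasoning

≐-refl : (X : RelOn C n) → X ≐ X
≐-refl X v = ⇔-refl

≐-sym : {X Y : RelOn C n} → X ≐ Y → Y ≐ X
≐-sym X≐Y v = ⇔-sym (X≐Y v)

≐-trans : {X Y Z : RelOn C n} → X ≐ Y → Y ≐ Z → X ≐ Z
≐-trans X≐Y Y≐Z v = ⇔-trans (X≐Y v) (Y≐Z v)

⊗-cong : {X X′ : RelOn C m} {Y Y′ : RelOn C n} → X ≐ X′ → Y ≐ Y′ → (X ⊗ Y) ≐ (X′ ⊗ Y′)
⊗-cong {m = m} X≐X′ Y≐Y′ v = X≐X′ (take m v) ×-⇔ Y≐Y′ (drop m v)

NonEmpty : RelOn C n → Set
NonEmpty {C} {n} X = Σ[ v ∈ Vec C n ] X v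

Empty : RelOn C n → Set
Empty X = ∀ v → ¬ X v

nonempty-or-empty : ExcludedMiddle (lsuc lzero) → (X : RelOn C n) → NonEmpty X ⊎ Empty X
nonempty-or-empty lem X with decide lem (NonEmpty X)
... | yes ne = inj₁ ne
... | no ¬ne = inj₂ λ v x → ¬ne (v , x)

empty-≐ : {X Y : RelOn C n} → Empty X → Empty Y → X ≐ Y
empty-≐ EX EY v = (λ x → ⊥-elim (EX v x)) , (λ y → ⊥-elim (EY v y))

⊗-nonempty : (X : RelOn C m) (Y : RelOn C n) → NonEmpty X → NonEmpty Y → NonEmpty (X ⊗ Y)
⊗-nonempty X Y (xs , x) (ys , y) = xs ++ ys , subst X (sym (take-++ xs ys)) x , subst Y (sym (drop-++ xs ys)) y

⊗-empty : (X : RelOn C m) (Y : RelOn C n) → Empty X ⊎ Empty Y → Empty (X ⊗ Y)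
⊗-empty {m = m} X Y (inj₁ EX) v (x , _) = EX (take m v) x
⊗-empty {m = m} X Y (inj₂ EY) v (_ , y) = EY (drop m v) y

Pr-allFin : (R : RelOn C n) → Pr (allFin n) R ≐ R
Pr-allFin R v = (λ (w , r , w≡v) → subst R (trans (sym (map-lookup-allFin w)) w≡v) r)
              , (λ r → v , r , map-lookup-allFin v)

Pr-nonempty : (is : Vec (Fin N) n) (R : RelOn C N) {X : RelOn C n} → Pr is R ≐ X → NonEmpty X → NonEmpty R
Pr-nonempty is R Pr≐X (v , x) with proj₂ (Pr≐X v) x
... | w , r , _ = w , r

Pr-take : (is : Vec (Fin N) (m + n)) (R : RelOn C N) {X : RelOn C m} {Y : RelOn C n}
        → Pr is R ≐ (X ⊗ Y) → NonEmpty Y → Pr (take m is) R ≐ X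
Pr-take {m = m} is R {X} {Y} Pr≐X⊗Y (ys , y) xs = to , from
  where
  to : Pr (take m is) R xs → X xs
  to (v , r , refl) = subst X (take-map (lookup v) m is) (proj₁ (proj₁ (Pr≐X⊗Y _) (v , r , refl)))
  from : X xs → Pr (take m is) R xs
  from x with proj₂ (Pr≐X⊗Y (xs ++ ys)) (subst X (sym (take-++ xs ys)) x , subst Y (sym (drop-++ xs ys)) y)
  ... | v , r , v≡ = v , r , trans (sym (take-map (lookup v) m is)) (trans (cong (take m) v≡) (take-++ xs ys))

Pr-drop : (is : Vec (Fin N) (m + n)) (R : RelOn C N) {X : RelOn C m} {Y : RelOn C n}
        → Pr is R ≐ (X ⊗ Y) → NonEmpty X → Pr (drop m is) R ≐ Y
Pr-drop {m = m} is R {X} {Y} Pr≐X⊗Y (xs , x) ys = to , from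
  where
  to : Pr (drop m is) R ys → Y ys
  to (v , r , refl) = subst Y (drop-map (lookup v) m is) (proj₂ (proj₁ (Pr≐X⊗Y _) (v , r , refl)))
  from : Y ys → Pr (drop m is) R ys
  from y with proj₂ (Pr≐X⊗Y (xs ++ ys)) (subst X (sym (take-++ xs ys)) x , subst Y (sym (drop-++ xs ys)) y)
  ... | v , r , v≡ = v , r , trans (sym (drop-map (lookup v) m is)) (trans (cong (drop m) v≡) (drop-++ xs ys))

prefixed : Vec C k → RelOn C n → RelOn C (k + n)
prefixed []       X = X
prefixed (a ∷ as) X = extTeam (prefixed as X) a

prefixed-intro : (as : Vec C k) (X : RelOn C n) {xs : Vec C n} → X xs → prefixed as X (as ++ xs)
prefixed-intro []       X x = x
prefixed-intro (a ∷ as) X x = prefixed-intro as X x , refl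

prefixed-elim : (as : Vec C k) (X : RelOn C n) {s : Vec C (k + n)}
              → prefixed as X s → Σ[ xs ∈ Vec C n ] (X xs × s ≡ as ++ xs)
prefixed-elim []       X {s} x = s , x , refl
prefixed-elim (a ∷ as) X {_ ∷ s} (t , refl) with prefixed-elim as X t
... | xs , x , refl = xs , x , refl

prefixed-nonempty : (as : Vec C k) (X : RelOn C n) → NonEmpty X → NonEmpty (prefixed as X)
prefixed-nonempty as X (xs , x) = as ++ xs , prefixed-intro as X x

∀-prefixed : (as : Vec C k) (X : RelOn C n) (F : Vec C (k + n) → Set)
           → (∀ s → prefixed as X s → F s) ⇔ (∀ xs → X xs → F (as ++ xs))
∀-prefixed as X F = (λ h xs x → h (as ++ xs) (prefixed-intro as X x)) , from
  where
  from : (∀ xs → X xs → F (as ++ xs)) → ∀ s → prefixed as X s → F s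
  from h s t with prefixed-elim as X t
  ... | xs , x , refl = h xs x

Σ-prefixed : (as : Vec C k) (X : RelOn C n) (F : Vec C (k + n) → Set)
           → (Σ[ s ∈ Vec C (k + n) ] (prefixed as X s × F s)) ⇔ (Σ[ xs ∈ Vec C n ] (X xs × F (as ++ xs)))
Σ-prefixed as X F = to , (λ (xs , x , y) → as ++ xs , prefixed-intro as X x , y)
  where
  to : Σ[ s ∈ _ ] (prefixed as X s × F s) → Σ[ xs ∈ _ ] (X xs × F (as ++ xs))
  to (s , t , y) with prefixed-elim as X t
  ... | xs , x , refl = xs , x , y

∀-nonempty : {X : RelOn C n} → NonEmpty X → (∀ v → X v → P) ⇔ P
∀-nonempty (v , x) = (λ h → h v x) , (λ p _ _ → p)

∀-prefixed-const : {P : Set} (as : Vec C k) (X : RelOn C n) → NonEmpty X → (F : Vec C (k + n) → Set)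
                 → (∀ xs → F (as ++ xs) ⇔ P) → (∀ s → prefixed as X s → F s) ⇔ P
∀-prefixed-const as X ne F F⇔P =
  ⇔-trans (∀-prefixed as X F) (⇔-trans (Π-⇔ λ xs → →-⇔ ⇔-refl (F⇔P xs)) (∀-nonempty ne))

∀-prefixed² : (zs : Vec C m) (as : Vec C k) (X : RelOn C n) (F : Vec C (m + (k + n)) → Set)
            → (∀ s → prefixed zs (prefixed as X) s → F s) ⇔ (∀ xs → X xs → F (zs ++ (as ++ xs)))
∀-prefixed² zs as X F = ⇔-trans (∀-prefixed zs (prefixed as X) F) (∀-prefixed as X (F ∘ (zs ++_)))

Σ-prefixed² : (zs : Vec C m) (as : Vec C k) (X : RelOn C n) (F : Vec C (m + (k + n)) → Set)
            → (Σ[ s ∈ _ ] (prefixed zs (prefixed as X) s × F s))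
              ⇔ (Σ[ xs ∈ _ ] (X xs × F (zs ++ (as ++ xs))))
Σ-prefixed² zs as X F = ⇔-trans (Σ-prefixed zs (prefixed as X) F) (Σ-prefixed as X (F ∘ (zs ++_)))

tupleᴿ : Vec C k → RelOn C k
tupleᴿ []       = fullᴿ 0
tupleᴿ (a ∷ as) = singᴿ a ⊗ tupleᴿ as

tupleᴿ-elim : (as : Vec C k) {v : Vec C k} → tupleᴿ as v → v ≡ as
tupleᴿ-elim []       {[]}    _        = refl
tupleᴿ-elim (a ∷ as) {_ ∷ v} (x≡a , t) = cong₂ _∷_ (proj₁ (∷-injective x≡a)) (tupleᴿ-elim as t)

tupleᴿ-intro : (as : Vec C k) → tupleᴿ as as
tupleᴿ-intro []       = tt
tupleᴿ-intro (a ∷ as) = refl , tupleᴿ-intro as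

tupleᴿ-⊗ : (as : Vec C k) (X : RelOn C n) → (tupleᴿ as ⊗ X) ≐ prefixed as X
tupleᴿ-⊗ {k = k} as X v = to , from
  where
  to : (tupleᴿ as ⊗ X) v → prefixed as X v
  to (t , x) = subst (prefixed as X) v≡ (prefixed-intro as X x)
    where
    v≡ : as ++ drop k v ≡ v
    v≡ = trans (cong (_++ drop k v) (sym (tupleᴿ-elim as t))) (take++drop≡id k v)
  from : prefixed as X v → (tupleᴿ as ⊗ X) v
  from t with prefixed-elim as X t
  ... | xs , x , refl = subst (tupleᴿ as) (sym (take-++ as xs)) (tupleᴿ-intro as)
                      , subst X (sym (drop-++ as xs)) x

extTeam-cong : {X Y : RelOn C n} (a : C) → X ≐ Y → extTeam X a ≐ extTeam Y a
extTeam-cong a X≐Y (_ ∷ v) = X≐Y v ×-⇔ ⇔-refl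

TSat-cong : {τ : Sig} (M : Structure τ) (φ : FOT τ n) {X Y : RelOn (Carrier M) n}
          → X ≐ Y → TSat M X φ → TSat M Y φ
TSat-cong M (atRel r ts)  X≐Y h s y = h s (proj₂ (X≐Y s) y)
TSat-cong M (atEq t u)    X≐Y h s y = h s (proj₂ (X≐Y s) y)
TSat-cong M (incl xs ys)  X≐Y h s y with h s (proj₂ (X≐Y s) y)
... | s′ , x′ , eq′ = s′ , proj₁ (X≐Y s′) x′ , eq′
TSat-cong M (const xs)    X≐Y h s s′ y y′ = h s s′ (proj₂ (X≐Y s) y) (proj₂ (X≐Y s′) y′)
TSat-cong M (wneg φ)      X≐Y (inj₁ EX) = inj₁ λ s y → EX s (proj₂ (X≐Y s) y)
TSat-cong M (wneg φ)      X≐Y (inj₂ ¬h) = inj₂ (¬h ∘ TSat-cong M φ (≐-sym X≐Y))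
TSat-cong M (cconj φ ψ)   X≐Y (h , h′) = TSat-cong M φ X≐Y h , TSat-cong M ψ X≐Y h′
TSat-cong M (cdisj φ ψ)   X≐Y (inj₁ h) = inj₁ (TSat-cong M φ X≐Y h)
TSat-cong M (cdisj φ ψ)   X≐Y (inj₂ h) = inj₂ (TSat-cong M ψ X≐Y h)
TSat-cong M (ex1 φ)       X≐Y (a , h) = a , TSat-cong M φ (extTeam-cong a X≐Y) h
TSat-cong M (all1 φ)      X≐Y h a = TSat-cong M φ (extTeam-cong a X≐Y) (h a)

TSat-≐ : {τ : Sig} (M : Structure τ) (φ : FOT τ n) {X Y : RelOn (Carrier M) n}
       → X ≐ Y → TSat M X φ ⇔ TSat M Y φ
TSat-≐ M φ X≐Y = TSat-cong M φ X≐Y , TSat-cong M φ (≐-sym X≐Y)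

extTeam-empty : (X : RelOn C n) (a : C) → Empty X → Empty (extTeam X a)
extTeam-empty X a EX (_ ∷ v) (x , _) = EX v x

-- On an empty team only ex1 has content: it asks for an element of the carrier.
TSat-empty-transfer : {τ : Sig} (M M′ : Structure τ)
                    → (Carrier M → Carrier M′) → (Carrier M′ → Carrier M)
                    → (φ : FOT τ n) {X : RelOn (Carrier M) n} {Y : RelOn (Carrier M′) n}
                    → Empty Y → TSat M X φ → TSat M′ Y φ
TSat-empty-transfer M M′ g g′ (atRel r ts) EY _ s y     = ⊥-elim (EY s y)
TSat-empty-transfer M M′ g g′ (atEq t u)   EY _ s y     = ⊥-elim (EY s y)
TSat-empty-transfer M M′ g g′ (incl xs ys) EY _ s y     = ⊥-elim (EY s y)
TSat-empty-transfer M M′ g g′ (const xs)   EY _ s _ y _ = ⊥-elim (EY s y)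
TSat-empty-transfer M M′ g g′ (wneg φ)     EY _         = inj₁ EY
TSat-empty-transfer M M′ g g′ (cconj φ ψ)  EY (h , h′)  =
  TSat-empty-transfer M M′ g g′ φ EY h , TSat-empty-transfer M M′ g g′ ψ EY h′
TSat-empty-transfer M M′ g g′ (cdisj φ ψ)  EY (inj₁ h)  = inj₁ (TSat-empty-transfer M M′ g g′ φ EY h)
TSat-empty-transfer M M′ g g′ (cdisj φ ψ)  EY (inj₂ h)  = inj₂ (TSat-empty-transfer M M′ g g′ ψ EY h)
TSat-empty-transfer M M′ g g′ (ex1 φ) {Y = Y} EY (a , h) =
  g a , TSat-empty-transfer M M′ g g′ φ (extTeam-empty Y (g a) EY) h
TSat-empty-transfer M M′ g g′ (all1 φ) {Y = Y} EY h b =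
  TSat-empty-transfer M M′ g g′ φ (extTeam-empty Y b EY) (h (g′ b))

module _ {τ : Sig} where

  trueᵀ : FOT τ n
  trueᵀ = incl [] []

  falseᵀ : FOT τ n
  falseᵀ = wneg trueᵀ

  TSat-trueᵀ : (M : Structure τ) (X : RelOn (Carrier M) n) → TSat M X trueᵀ
  TSat-trueᵀ M X s x = s , x , refl

  TSat-falseᵀ : (M : Structure τ) (X : RelOn (Carrier M) n) → TSat M X falseᵀ ⇔ Empty X
  TSat-falseᵀ M X = [ id , (λ ¬true → ⊥-elim (¬true (TSat-trueᵀ M X))) ]′ , inj₁

  TSat-wneg-nonempty : (M : Structure τ) {X : RelOn (Carrier M) n} (φ : FOT τ n)
                     → NonEmpty X → TSat M X (wneg φ) ⇔ (¬ TSat M X φ)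
  TSat-wneg-nonempty M φ (v , x) = [ (λ EX → ⊥-elim (EX v x)) , id ]′ , inj₂

  eqsᵀ : Vec (Term τ m) k → Vec (Term τ m) k → FOT τ m
  eqsᵀ []       []       = trueᵀ
  eqsᵀ (t ∷ ts) (u ∷ us) = cconj (atEq t u) (eqsᵀ ts us)

  TSat-eqsᵀ : (M : Structure τ) (X : RelOn (Carrier M) m) (ts us : Vec (Term τ m) k)
            → TSat M X (eqsᵀ ts us) ⇔ (∀ s → X s → evalTs M ts s ≡ evalTs M us s)
  TSat-eqsᵀ M X []       []       = (λ _ _ _ → refl) , (λ _ → TSat-trueᵀ M X)
  TSat-eqsᵀ M X (t ∷ ts) (u ∷ us) =
      (λ (h , h′) s x → cong₂ _∷_ (h s x) (proj₁ (TSat-eqsᵀ M X ts us) h′ s x))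
    , (λ h → (λ s x → proj₁ (∷-injective (h s x)))
           , proj₂ (TSat-eqsᵀ M X ts us) (λ s x → proj₂ (∷-injective (h s x))))

  ∃ᵀⁿ : (n : ℕ) → FOT τ (n + m) → FOT τ m
  ∃ᵀⁿ zero    φ = φ
  ∃ᵀⁿ (suc n) φ = ∃ᵀⁿ n (ex1 φ)

  TSat-∃ᵀⁿ : (M : Structure τ) (n : ℕ) (φ : FOT τ (n + m)) (X : RelOn (Carrier M) m)
           → TSat M X (∃ᵀⁿ n φ) ⇔ (Σ[ zs ∈ Vec (Carrier M) n ] TSat M (prefixed zs X) φ)
  TSat-∃ᵀⁿ M zero    φ X = (λ h → [] , h) , (λ { ([] , h) → h })
  TSat-∃ᵀⁿ M (suc n) φ X = ⇔-trans (TSat-∃ᵀⁿ M n (ex1 φ) X)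
    ((λ (zs , a , h) → a ∷ zs , h) , (λ { (a ∷ zs , h) → zs , a , h }))

vars : {σ : Sig} → Vec (Fin m) k → Vec (Term σ m) k
vars = map var

evalTs-vars : {σ : Sig} (M : Structure σ) (is : Vec (Fin m) k) (s : Vec (Carrier M) m)
            → evalTs M (vars is) s ≡ map (lookup s) is
evalTs-vars M []       s = refl
evalTs-vars M (i ∷ is) s = cong (lookup s i ∷_) (evalTs-vars M is s)

evalTs-vars-rename : {σ : Sig} (M : Structure σ) {m₀ m₁ : ℕ} {ρ : Fin m₀ → Fin m₁}
                     (s : Vec (Carrier M) m₀) (s′ : Vec (Carrier M) m₁)
                   → (∀ i → lookup s′ (ρ i) ≡ lookup s i) → (is : Vec (Fin m₀) k)
                   → evalTs M (vars (map ρ is)) s′ ≡ map (lookup s) is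
evalTs-vars-rename M s s′ ρ-ok is = trans (evalTs-vars M _ s′) (map-lookup-rename s s′ ρ-ok is)

module _ {τ : Sig} {E : Set₁} {ear : E → ℕ} where
  private
    σ = expandSig τ E ear

  mutual
    reductT : {m₀ m₁ : ℕ} → (Fin m₀ → Fin m₁) → Term σ m₀ → Term τ m₁
    reductT ρ (var i)     = var (ρ i)
    reductT ρ (con c)     = con c
    reductT ρ (fapp g ts) = fapp g (reductTs ρ ts)

    reductTs : {m₀ m₁ : ℕ} → (Fin m₀ → Fin m₁) → Vec (Term σ m₀) k → Vec (Term τ m₁) k
    reductTs ρ []       = []
    reductTs ρ (t ∷ ts) = reductT ρ t ∷ reductTs ρ ts

  mutual
    expandT : {m₀ m₁ : ℕ} → (Fin m₀ → Fin m₁) → Term τ m₀ → Term σ m₁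
    expandT ρ (var i)     = var (ρ i)
    expandT ρ (con c)     = con c
    expandT ρ (fapp g ts) = fapp g (expandTs ρ ts)

    expandTs : {m₀ m₁ : ℕ} → (Fin m₀ → Fin m₁) → Vec (Term τ m₀) k → Vec (Term σ m₁) k
    expandTs ρ []       = []
    expandTs ρ (t ∷ ts) = expandT ρ t ∷ expandTs ρ ts

  module _ (M : Structure τ) (I : (e : E) → RelOn (Carrier M) (ear e))
           {m₀ m₁ : ℕ} {ρ : Fin m₀ → Fin m₁} {s : Vec (Carrier M) m₀} {s′ : Vec (Carrier M) m₁}
           (ρ-ok : ∀ i → lookup s′ (ρ i) ≡ lookup s i) where
    private
      M⁺ = expandStr M E ear I

    mutual
      evalT-reductT : (t : Term σ m₀) → evalT M (reductT ρ t) s′ ≡ evalT M⁺ t s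
      evalT-reductT (var i)     = ρ-ok i
      evalT-reductT (con c)     = refl
      evalT-reductT (fapp g ts) = cong (funI M g) (evalTs-reductTs ts)

      evalTs-reductTs : (ts : Vec (Term σ m₀) k) → evalTs M (reductTs ρ ts) s′ ≡ evalTs M⁺ ts s
      evalTs-reductTs []       = refl
      evalTs-reductTs (t ∷ ts) = cong₂ _∷_ (evalT-reductT t) (evalTs-reductTs ts)

    mutual
      evalT-expandT : (t : Term τ m₀) → evalT M⁺ (expandT ρ t) s′ ≡ evalT M t s
      evalT-expandT (var i)     = ρ-ok i
      evalT-expandT (con c)     = refl
      evalT-expandT (fapp g ts) = cong (funI M g) (evalTs-expandTs ts)

      evalTs-expandTs : (ts : Vec (Term τ m₀) k) → evalTs M⁺ (expandTs ρ ts) s′ ≡ evalTs M ts s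
      evalTs-expandTs []       = refl
      evalTs-expandTs (t ∷ ts) = cong₂ _∷_ (evalT-expandT t) (evalTs-expandTs ts)

module _ {σ : Sig} where

  ⊤F : FO σ m
  ⊤F = all (eq (var zero) (var zero))

  ⊥F : FO σ m
  ⊥F = neg ⊤F

  Sat-⊥F : (M : Structure σ) (s : Vec (Carrier M) m) → Sat M ⊥F s ⇔ ⊥
  Sat-⊥F M s = (λ ¬true → ¬true λ _ → refl) , ⊥-elim

  _⇒F_ : FO σ m → FO σ m → FO σ m
  φ ⇒F ψ = disj (neg φ) ψ

  _⇔F_ : FO σ m → FO σ m → FO σ m
  φ ⇔F ψ = conj (φ ⇒F ψ) (ψ ⇒F φ)

  eqsF : Vec (Term σ m) k → Vec (Term σ m) k → FO σ m
  eqsF []       []       = ⊤F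
  eqsF (t ∷ ts) (u ∷ us) = conj (eq t u) (eqsF ts us)

  ∀ⁿ : (n : ℕ) → FO σ (n + m) → FO σ m
  ∀ⁿ zero    φ = φ
  ∀ⁿ (suc n) φ = ∀ⁿ n (all φ)

  ∃ⁿ : (n : ℕ) → FO σ (n + m) → FO σ m
  ∃ⁿ zero    φ = φ
  ∃ⁿ (suc n) φ = ∃ⁿ n (ex φ)

  module _ (M : Structure σ) where

    Sat-eqsF : (ts us : Vec (Term σ m) k) (s : Vec (Carrier M) m)
             → Sat M (eqsF ts us) s ⇔ (evalTs M ts s ≡ evalTs M us s)
    Sat-eqsF []       []       s = (λ _ → refl) , (λ _ _ → refl)
    Sat-eqsF (t ∷ ts) (u ∷ us) s =
        (λ (h , h′) → cong₂ _∷_ h (proj₁ (Sat-eqsF ts us s) h′))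
      , (λ h → proj₁ (∷-injective h) , proj₂ (Sat-eqsF ts us s) (proj₂ (∷-injective h)))

    Sat-∀ⁿ : (n : ℕ) (φ : FO σ (n + m)) (s : Vec (Carrier M) m)
           → Sat M (∀ⁿ n φ) s ⇔ (∀ xs → Sat M φ (xs ++ s))
    Sat-∀ⁿ zero    φ s = (λ h → λ { [] → h }) , (λ h → h [])
    Sat-∀ⁿ (suc n) φ s = ⇔-trans (Sat-∀ⁿ n (all φ) s)
      ((λ h → λ { (x ∷ xs) → h xs x }) , (λ h xs x → h (x ∷ xs)))

    Sat-∃ⁿ : (n : ℕ) (φ : FO σ (n + m)) (s : Vec (Carrier M) m)
           → Sat M (∃ⁿ n φ) s ⇔ (Σ[ xs ∈ Vec (Carrier M) n ] Sat M φ (xs ++ s))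
    Sat-∃ⁿ zero    φ s = (λ h → [] , h) , (λ { ([] , h) → h })
    Sat-∃ⁿ (suc n) φ s = ⇔-trans (Sat-∃ⁿ n (ex φ) s)
      ((λ (xs , x , h) → x ∷ xs , h) , (λ { (x ∷ xs , h) → xs , x , h }))

    module _ (lem : ExcludedMiddle (lsuc lzero)) where

      Sat-⇒F : (φ ψ : FO σ m) (s : Vec (Carrier M) m) → Sat M (φ ⇒F ψ) s ⇔ (Sat M φ s → Sat M ψ s)
      Sat-⇒F φ ψ s = ¬⊎⇔→ (decide lem (Sat M φ s))

      Sat-⇔F : (φ ψ : FO σ m) (s : Vec (Carrier M) m) → Sat M (φ ⇔F ψ) s ⇔ (Sat M φ s ⇔ Sat M ψ s)
      Sat-⇔F φ ψ s = Sat-⇒F φ ψ s ×-⇔ Sat-⇒F ψ φ s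

module TeamAsSymbol {τ : Sig} {E : Set₁} {ear : E → ℕ} (e : E) where
  private
    σ = expandSig τ E ear
    arₑ = ear e

  inTeam : Vec (Fin m) arₑ → FO σ m
  inTeam is = rel (inj₂ e) (vars is)

  ∀∈ : FO σ (arₑ + m) → FO σ m
  ∀∈ {m} φ = ∀ⁿ arₑ (inTeam (firsts arₑ m) ⇒F φ)

  ∃∈ : FO σ (arₑ + m) → FO σ m
  ∃∈ {m} φ = ∃ⁿ arₑ (conj (inTeam (firsts arₑ m)) φ)

  -- toFO quantifies a team tuple xs in front of the prefix as, so the team assignment as ++ xs is stored
  -- as xs ++ as, and a second team tuple ys as ys ++ (xs ++ as). swap i locates entry i of as ++ xs in
  -- xs ++ as; outer i and inner i locate entry i of as ++ xs and of as ++ ys in ys ++ (xs ++ as).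
  swap : Fin (k + arₑ) → Fin (arₑ + k)
  swap {k} i = [ arₑ ↑ʳ_ , _↑ˡ k ]′ (splitAt k i)

  outer : Fin (k + arₑ) → Fin (arₑ + (arₑ + k))
  outer i = arₑ ↑ʳ swap i

  inner : Fin (k + arₑ) → Fin (arₑ + (arₑ + k))
  inner {k} i = [ (λ j → arₑ ↑ʳ (arₑ ↑ʳ j)) , _↑ˡ (arₑ + k) ]′ (splitAt k i)

  toFO : FOT τ (k + arₑ) → FO σ k
  toFO (atRel r ts) = ∀∈ (rel (inj₁ r) (expandTs swap ts))
  toFO (atEq t u)   = ∀∈ (eq (expandT swap t) (expandT swap u))
  toFO (incl xs ys) = ∀∈ (∃∈ (eqsF (vars (map outer xs)) (vars (map inner ys))))
  toFO (const xs)   = ∀∈ (∀∈ (eqsF (vars (map outer xs)) (vars (map inner xs))))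
  toFO (wneg φ)     = disj (∀∈ ⊥F) (neg (toFO φ))
  toFO (cconj φ ψ)  = conj (toFO φ) (toFO ψ)
  toFO (cdisj φ ψ)  = disj (toFO φ) (toFO ψ)
  toFO (ex1 φ)      = ex (toFO φ)
  toFO (all1 φ)     = all (toFO φ)

  module _ (lem : ExcludedMiddle (lsuc lzero)) (M : Structure τ) (I : (e : E) → RelOn (Carrier M) (ear e)) where
    private
      M⁺ = expandStr M E ear I
      D = Carrier M
      X = I e

    Sat-inTeam-firsts : (xs : Vec D arₑ) (s : Vec D m) → Sat M⁺ (inTeam (firsts arₑ m)) (xs ++ s) ⇔ X xs
    Sat-inTeam-firsts xs s = subst-⇔ X (trans (evalTs-vars M⁺ _ _) (map-lookup-firsts xs s))

    Sat-∀∈ : (φ : FO σ (arₑ + m)) (s : Vec D m)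
           → Sat M⁺ (∀∈ φ) s ⇔ (∀ xs → X xs → Sat M⁺ φ (xs ++ s))
    Sat-∀∈ {m} φ s = ⇔-trans (Sat-∀ⁿ M⁺ arₑ (inTeam (firsts arₑ m) ⇒F φ) s) (Π-⇔ λ xs →
      ⇔-trans (Sat-⇒F M⁺ lem (inTeam (firsts arₑ m)) φ (xs ++ s))
              (→-⇔ (Sat-inTeam-firsts xs s) ⇔-refl))

    Sat-∃∈ : (φ : FO σ (arₑ + m)) (s : Vec D m)
           → Sat M⁺ (∃∈ φ) s ⇔ (Σ[ xs ∈ Vec D arₑ ] (X xs × Sat M⁺ φ (xs ++ s)))
    Sat-∃∈ {m} φ s = ⇔-trans (Sat-∃ⁿ M⁺ arₑ (conj (inTeam (firsts arₑ m)) φ) s)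
                             (Σ-⇔ λ xs → Sat-inTeam-firsts xs s ×-⇔ ⇔-refl)

    team-∀ : (as : Vec D k) (F : Vec D (k + arₑ) → Set) (φ : FO σ (arₑ + m)) (s : Vec D m)
           → (∀ xs → F (as ++ xs) ⇔ Sat M⁺ φ (xs ++ s))
           → (∀ t → prefixed as X t → F t) ⇔ Sat M⁺ (∀∈ φ) s
    team-∀ as F φ s F⇔φ = begin
      (∀ t → prefixed as X t → F t)        ⇔⟨ ∀-prefixed as X F ⟩
      (∀ xs → X xs → F (as ++ xs))         ⇔⟨ Π-⇔ (λ xs → →-⇔ ⇔-refl (F⇔φ xs)) ⟩
      (∀ xs → X xs → Sat M⁺ φ (xs ++ s))   ⇔˘⟨ Sat-∀∈ φ s ⟩
      Sat M⁺ (∀∈ φ) s                      ∎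
      where open ⇔-Reasoning

    team-∃ : (as : Vec D k) (F : Vec D (k + arₑ) → Set) (φ : FO σ (arₑ + m)) (s : Vec D m)
           → (∀ xs → F (as ++ xs) ⇔ Sat M⁺ φ (xs ++ s))
           → (Σ[ t ∈ Vec D (k + arₑ) ] (prefixed as X t × F t)) ⇔ Sat M⁺ (∃∈ φ) s
    team-∃ as F φ s F⇔φ = begin
      (Σ[ t ∈ _ ] (prefixed as X t × F t))        ⇔⟨ Σ-prefixed as X F ⟩
      (Σ[ xs ∈ _ ] (X xs × F (as ++ xs)))         ⇔⟨ Σ-⇔ (λ xs → ⇔-refl ×-⇔ F⇔φ xs) ⟩
      (Σ[ xs ∈ _ ] (X xs × Sat M⁺ φ (xs ++ s)))   ⇔˘⟨ Sat-∃∈ φ s ⟩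
      Sat M⁺ (∃∈ φ) s                             ∎
      where open ⇔-Reasoning

    lookup-swap : (as : Vec D k) (xs : Vec D arₑ) → ∀ i → lookup (xs ++ as) (swap i) ≡ lookup (as ++ xs) i
    lookup-swap as xs = lookup-[,]∘splitAt (xs ++ as) as xs (lookup-++ʳ xs as) (lookup-++ˡ xs as)

    lookup-outer : (as : Vec D k) (xs ys : Vec D arₑ)
                 → ∀ i → lookup (ys ++ (xs ++ as)) (outer i) ≡ lookup (as ++ xs) i
    lookup-outer as xs ys i = trans (lookup-++ʳ ys (xs ++ as) (swap i)) (lookup-swap as xs i)

    lookup-inner : (as : Vec D k) (xs ys : Vec D arₑ)
                 → ∀ i → lookup (ys ++ (xs ++ as)) (inner i) ≡ lookup (as ++ ys) i
    lookup-inner as xs ys = lookup-[,]∘splitAt (ys ++ (xs ++ as)) as ys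
      (λ j → trans (lookup-++ʳ ys (xs ++ as) (arₑ ↑ʳ j)) (lookup-++ʳ xs as j)) (lookup-++ˡ ys (xs ++ as))

    Sat-eqsF-outer-inner : (as : Vec D k) (xs ys : Vec D arₑ) (is js : Vec (Fin (k + arₑ)) m)
      → (map (lookup (as ++ xs)) is ≡ map (lookup (as ++ ys)) js)
        ⇔ Sat M⁺ (eqsF (vars (map outer is)) (vars (map inner js))) (ys ++ (xs ++ as))
    Sat-eqsF-outer-inner as xs ys is js = ⇔-sym (⇔-trans (Sat-eqsF M⁺ _ _ (ys ++ (xs ++ as)))
      (≡-⇔ (evalTs-vars-rename M⁺ (as ++ xs) _ (lookup-outer as xs ys) is)
           (evalTs-vars-rename M⁺ (as ++ ys) _ (lookup-inner as xs ys) js)))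

    Sat-toFO : (φ : FOT τ (k + arₑ)) (as : Vec D k) → TSat M (prefixed as X) φ ⇔ Sat M⁺ (toFO φ) as
    Sat-toFO (atRel r ts) as = team-∀ as _ _ as λ xs →
      subst-⇔ (relI M r) (sym (evalTs-expandTs M I (lookup-swap as xs) ts))
    Sat-toFO (atEq t u) as = team-∀ as _ _ as λ xs →
      ≡-⇔ (sym (evalT-expandT M I (lookup-swap as xs) t)) (sym (evalT-expandT M I (lookup-swap as xs) u))
    Sat-toFO (incl is js) as = team-∀ as _ _ as λ xs → team-∃ as _ _ (xs ++ as) λ ys →
      Sat-eqsF-outer-inner as xs ys is js
    Sat-toFO (const is) as = ⇔-trans reorder (team-∀ as _ _ as λ xs → team-∀ as _ _ (xs ++ as) λ ys →
      Sat-eqsF-outer-inner as xs ys is is)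
      where
      reorder : {T : Vec D (k + arₑ) → Set} {F : Vec D (k + arₑ) → Vec D (k + arₑ) → Set}
              → (∀ t t′ → T t → T t′ → F t t′) ⇔ (∀ t → T t → ∀ t′ → T t′ → F t t′)
      reorder = (λ h t x t′ x′ → h t t′ x x′) , (λ h t t′ x x′ → h t x t′ x′)
    Sat-toFO (wneg φ) as =
      team-∀ as _ ⊥F as (λ xs → ⇔-sym (Sat-⊥F M⁺ (xs ++ as))) ⊎-⇔ ¬-⇔ (Sat-toFO φ as)
    Sat-toFO (cconj φ ψ) as = Sat-toFO φ as ×-⇔ Sat-toFO ψ as
    Sat-toFO (cdisj φ ψ) as = Sat-toFO φ as ⊎-⇔ Sat-toFO ψ as
    Sat-toFO (ex1 φ) as = Σ-⇔ λ a → Sat-toFO φ (a ∷ as)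
    Sat-toFO (all1 φ) as = Π-⇔ λ a → Sat-toFO φ (a ∷ as)

Occupied : Bool → RelOn C n → Set
Occupied true  X = NonEmpty X
Occupied false X = Empty X

slotArity : Bool → ℕ → ℕ
slotArity true  n = n
slotArity false _ = 0

-- An empty parameter would empty the whole team, so it gets no columns and its atoms become falseᵀ.
slot : (b : Bool) → RelOn C n → RelOn C (slotArity b n)
slot true  X = X
slot false _ = fullᴿ 0

slot-nonempty : (b : Bool) (X : RelOn C n) → Occupied b X → NonEmpty (slot b X)
slot-nonempty true  X ne = ne
slot-nonempty false X _  = [] , tt

module ParamsAsTeam {τ : Sig} {E : Set₁} {ear : E → ℕ} (occupied : E → Bool) where
  private
    σ = expandSig τ E ear

  occArity : FO σ k → ℕ
  occArity (rel (inj₁ r) ts) = 0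
  occArity (rel (inj₂ e) ts) = slotArity (occupied e) (ear e)
  occArity (eq t u)          = 0
  occArity (neg φ)           = occArity φ
  occArity (conj φ ψ)        = occArity φ + occArity ψ
  occArity (disj φ ψ)        = occArity φ + occArity ψ
  occArity (all φ)           = occArity φ
  occArity (ex φ)            = occArity φ

  guessEqualsᵀ : {k n N : ℕ} → Vec (Term σ k) n → FOT τ (n + (k + N))
  guessEqualsᵀ {k} {n} {N} ts = eqsᵀ (vars (firsts n (k + N))) (reductTs (λ i → n ↑ʳ (i ↑ˡ N)) ts)

  guessInColumnᵀ : {k n N : ℕ} → Vec (Fin N) n → FOT τ (n + (k + N))
  guessInColumnᵀ {k} {n} {N} is = incl (firsts n (k + N)) (map (λ q → n ↑ʳ (k ↑ʳ q)) is)

  -- e(ts) for a parameter occupying the columns is: a guessed tuple zs equals ts and lies in those columns.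
  memberᵀ : (b : Bool) (n : ℕ) → Vec (Term σ k) n → Vec (Fin N) (slotArity b n) → FOT τ (k + N)
  memberᵀ false n ts is = falseᵀ
  memberᵀ true  n ts is = ∃ᵀⁿ n (cconj (guessEqualsᵀ ts) (guessInColumnᵀ is))

  toFOT : (φ : FO σ k) → Vec (Fin N) (occArity φ) → FOT τ (k + N)
  toFOT {N = N} (rel (inj₁ r) ts) is = atRel r (reductTs (_↑ˡ N) ts)
  toFOT (rel (inj₂ e) ts) is = memberᵀ (occupied e) (ear e) ts is
  toFOT {N = N} (eq t u) is = atEq (reductT (_↑ˡ N) t) (reductT (_↑ˡ N) u)
  toFOT (neg φ)    is = wneg (toFOT φ is)
  toFOT (conj φ ψ) is = cconj (toFOT φ (take (occArity φ) is)) (toFOT ψ (drop (occArity φ) is))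
  toFOT (disj φ ψ) is = cdisj (toFOT φ (take (occArity φ) is)) (toFOT ψ (drop (occArity φ) is))
  toFOT (all φ)    is = all1 (toFOT φ is)
  toFOT (ex φ)     is = ex1 (toFOT φ is)

  module _ (M : Structure τ) (I : (e : E) → RelOn (Carrier M) (ear e))
           (occ : ∀ e → Occupied (occupied e) (I e)) where
    private
      M⁺ = expandStr M E ear I
      D = Carrier M

    occurrences : (φ : FO σ k) → RelOn D (occArity φ)
    occurrences (rel (inj₁ r) ts) = fullᴿ 0
    occurrences (rel (inj₂ e) ts) = slot (occupied e) (I e)
    occurrences (eq t u)          = fullᴿ 0
    occurrences (neg φ)           = occurrences φ
    occurrences (conj φ ψ)        = occurrences φ ⊗ occurrences ψ
    occurrences (disj φ ψ)        = occurrences φ ⊗ occurrences ψ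
    occurrences (all φ)           = occurrences φ
    occurrences (ex φ)            = occurrences φ

    occurrences-nonempty : (φ : FO σ k) → NonEmpty (occurrences φ)
    occurrences-nonempty (rel (inj₁ r) ts) = [] , tt
    occurrences-nonempty (rel (inj₂ e) ts) = slot-nonempty (occupied e) (I e) (occ e)
    occurrences-nonempty (eq t u)          = [] , tt
    occurrences-nonempty (neg φ)           = occurrences-nonempty φ
    occurrences-nonempty (conj φ ψ)        =
      ⊗-nonempty (occurrences φ) (occurrences ψ) (occurrences-nonempty φ) (occurrences-nonempty ψ)
    occurrences-nonempty (disj φ ψ)        =
      ⊗-nonempty (occurrences φ) (occurrences ψ) (occurrences-nonempty φ) (occurrences-nonempty ψ)
    occurrences-nonempty (all φ)           = occurrences-nonempty φ
    occurrences-nonempty (ex φ)            = occurrences-nonempty φ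

    TSat-guessEqualsᵀ : {k N n : ℕ} (as : Vec D k) (R : RelOn D N) → NonEmpty R
                      → (zs : Vec D n) (ts : Vec (Term σ k) n)
                      → TSat M (prefixed zs (prefixed as R)) (guessEqualsᵀ {N = N} ts) ⇔ (zs ≡ evalTs M⁺ ts as)
    TSat-guessEqualsᵀ {k} {N} {n} as R neR zs ts = begin
      TSat M (prefixed zs (prefixed as R)) (eqsᵀ zvars tts)
        ⇔⟨ TSat-eqsᵀ M _ zvars tts ⟩
      (∀ s → prefixed zs (prefixed as R) s → evalTs M zvars s ≡ evalTs M tts s)
        ⇔⟨ ∀-prefixed² zs as R (λ s → evalTs M zvars s ≡ evalTs M tts s) ⟩
      (∀ w → R w → evalTs M zvars (zs ++ (as ++ w)) ≡ evalTs M tts (zs ++ (as ++ w)))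
        ⇔⟨ Π-⇔ (λ w → →-⇔ ⇔-refl (≡-⇔ (zvars-value w) (tts-value w))) ⟩
      (∀ w → R w → zs ≡ evalTs M⁺ ts as)
        ⇔⟨ ∀-nonempty neR ⟩
      zs ≡ evalTs M⁺ ts as
        ∎
      where
      open ⇔-Reasoning
      zvars = vars (firsts n (k + N))
      tts = reductTs (λ i → n ↑ʳ (i ↑ˡ N)) ts
      zvars-value : ∀ w → evalTs M zvars (zs ++ (as ++ w)) ≡ zs
      zvars-value w = trans (evalTs-vars M (firsts n (k + N)) _) (map-lookup-firsts zs (as ++ w))
      tts-value : ∀ w → evalTs M tts (zs ++ (as ++ w)) ≡ evalTs M⁺ ts as
      tts-value w = evalTs-reductTs M I (λ i → trans (lookup-++ʳ zs (as ++ w) (i ↑ˡ N)) (lookup-++ˡ as w i)) ts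

    TSat-guessInColumnᵀ : {k N n : ℕ} (as : Vec D k) (R : RelOn D N) → NonEmpty R
                        → (zs : Vec D n) (is : Vec (Fin N) n)
                        → TSat M (prefixed zs (prefixed as R)) (guessInColumnᵀ {k = k} is) ⇔ Pr is R zs
    TSat-guessInColumnᵀ {k} {N} {n} as R neR zs is = begin
      TSat M (prefixed zs T) (incl zcol col)
        ⇔⟨ ∀-prefixed² zs as R _ ⟩
      (∀ w → R w → Σ[ s ∈ _ ] (prefixed zs T s × map (lookup (zs ++ (as ++ w))) zcol ≡ map (lookup s) col))
        ⇔⟨ Π-⇔ (λ w → →-⇔ ⇔-refl (Σ-prefixed² zs as R _)) ⟩
      (∀ w → R w → Σ[ w′ ∈ _ ] (R w′ ×
                   map (lookup (zs ++ (as ++ w))) zcol ≡ map (lookup (zs ++ (as ++ w′))) col))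
        ⇔⟨ Π-⇔ (λ w → →-⇔ ⇔-refl (Σ-⇔ λ w′ → ⇔-refl ×-⇔ column w w′)) ⟩
      (∀ w → R w → Pr is R zs)
        ⇔⟨ ∀-nonempty neR ⟩
      Pr is R zs
        ∎
      where
      open ⇔-Reasoning
      T = prefixed as R
      zcol = firsts n (k + N)
      col = map (λ q → n ↑ʳ (k ↑ʳ q)) is
      column : ∀ w w′ → (map (lookup (zs ++ (as ++ w))) zcol ≡ map (lookup (zs ++ (as ++ w′))) col)
                        ⇔ (map (lookup w′) is ≡ zs)
      column w w′ = ⇔-trans
        (≡-⇔ (map-lookup-firsts zs (as ++ w)) (map-lookup-rename w′ (zs ++ (as ++ w′)) shift is)) sym-⇔
        where
        shift : ∀ q → lookup (zs ++ (as ++ w′)) (n ↑ʳ (k ↑ʳ q)) ≡ lookup w′ q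
        shift q = trans (lookup-++ʳ zs (as ++ w′) (k ↑ʳ q)) (lookup-++ʳ as w′ q)

    TSat-memberᵀ : (b : Bool) {n : ℕ} (X : RelOn D n) → Occupied b X → (ts : Vec (Term σ k) n)
                   (is : Vec (Fin N) (slotArity b n)) (R : RelOn D N) → Pr is R ≐ slot b X → NonEmpty R
                 → (as : Vec D k) → TSat M (prefixed as R) (memberᵀ b n ts is) ⇔ X (evalTs M⁺ ts as)
    TSat-memberᵀ false X EX ts is R _ neR as =
      (λ h → ⊥-elim (¬empty (proj₁ (TSat-falseᵀ M (prefixed as R)) h))) , (λ x → ⊥-elim (EX _ x))
      where
      ¬empty : ¬ Empty (prefixed as R)
      ¬empty E = E _ (proj₂ (prefixed-nonempty as R neR))
    TSat-memberᵀ true {n} X _ ts is R Pr≐X neR as = begin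
      TSat M (prefixed as R) (memberᵀ true n ts is)
        ⇔⟨ TSat-∃ᵀⁿ M n _ (prefixed as R) ⟩
      (Σ[ zs ∈ Vec D n ] (TSat M (prefixed zs (prefixed as R)) (guessEqualsᵀ ts)
                         × TSat M (prefixed zs (prefixed as R)) (guessInColumnᵀ is)))
        ⇔⟨ Σ-⇔ (λ zs → TSat-guessEqualsᵀ as R neR zs ts ×-⇔ TSat-guessInColumnᵀ as R neR zs is) ⟩
      (Σ[ zs ∈ Vec D n ] (zs ≡ evalTs M⁺ ts as × Pr is R zs))
        ⇔⟨ one-point ⟩
      Pr is R (evalTs M⁺ ts as)
        ⇔⟨ Pr≐X _ ⟩
      X (evalTs M⁺ ts as)
        ∎
      where open ⇔-Reasoning

    team-nonempty : (φ : FO σ k) (is : Vec (Fin N) (occArity φ)) (R : RelOn D N)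
                  → Pr is R ≐ occurrences φ → NonEmpty R
    team-nonempty φ is R Pr≐ = Pr-nonempty is R Pr≐ (occurrences-nonempty φ)

    TSat-toFOT : (φ : FO σ k) (is : Vec (Fin N) (occArity φ)) (R : RelOn D N) → Pr is R ≐ occurrences φ
               → (as : Vec D k) → TSat M (prefixed as R) (toFOT φ is) ⇔ Sat M⁺ φ as
    TSat-toFOT φ@(rel (inj₁ r) ts) is R Pr≐ as = ∀-prefixed-const as R (team-nonempty φ is R Pr≐) _ λ w →
      subst-⇔ (relI M r) (evalTs-reductTs M I (lookup-++ˡ as w) ts)
    TSat-toFOT φ@(rel (inj₂ e) ts) is R Pr≐ as =
      TSat-memberᵀ (occupied e) (I e) (occ e) ts is R Pr≐ (team-nonempty φ is R Pr≐) as
    TSat-toFOT φ@(eq t u) is R Pr≐ as = ∀-prefixed-const as R (team-nonempty φ is R Pr≐) _ λ w →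
      ≡-⇔ (evalT-reductT M I (lookup-++ˡ as w) t) (evalT-reductT M I (lookup-++ˡ as w) u)
    TSat-toFOT (neg φ) is R Pr≐ as =
      ⇔-trans (TSat-wneg-nonempty M (toFOT φ is) (prefixed-nonempty as R (team-nonempty φ is R Pr≐)))
              (¬-⇔ (TSat-toFOT φ is R Pr≐ as))
    TSat-toFOT (conj φ ψ) is R Pr≐ as =
      TSat-toFOT φ _ R (Pr-take is R Pr≐ (occurrences-nonempty ψ)) as
        ×-⇔ TSat-toFOT ψ _ R (Pr-drop is R Pr≐ (occurrences-nonempty φ)) as
    TSat-toFOT (disj φ ψ) is R Pr≐ as =
      TSat-toFOT φ _ R (Pr-take is R Pr≐ (occurrences-nonempty ψ)) as
        ⊎-⇔ TSat-toFOT ψ _ R (Pr-drop is R Pr≐ (occurrences-nonempty φ)) as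
    TSat-toFOT (all φ) is R Pr≐ as = Π-⇔ λ a → TSat-toFOT φ is R Pr≐ (a ∷ as)
    TSat-toFOT (ex φ)  is R Pr≐ as = Σ-⇔ λ a → TSat-toFOT φ is R Pr≐ (a ∷ as)

module _ {τ : Sig} {E E′ : Set₁} {ear′ : E′ → ℕ} (h : E → E′) where
  private
    σ = expandSig τ E (ear′ ∘ h)

  retagT : Term σ m → Term (expandSig τ E′ ear′) m
  retagT t = expandT id (reductT {E = E} {ear = ear′ ∘ h} id t)

  retagTs : Vec (Term σ m) k → Vec (Term (expandSig τ E′ ear′) m) k
  retagTs ts = expandTs id (reductTs {E = E} {ear = ear′ ∘ h} id ts)

  renameSyms : FO σ k → FO (expandSig τ E′ ear′) k
  renameSyms (rel (inj₁ r) ts) = rel (inj₁ r) (retagTs ts)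
  renameSyms (rel (inj₂ e) ts) = rel (inj₂ (h e)) (retagTs ts)
  renameSyms (eq t u)          = eq (retagT t) (retagT u)
  renameSyms (neg φ)    = neg (renameSyms φ)
  renameSyms (conj φ ψ) = conj (renameSyms φ) (renameSyms ψ)
  renameSyms (disj φ ψ) = disj (renameSyms φ) (renameSyms ψ)
  renameSyms (all φ)    = all (renameSyms φ)
  renameSyms (ex φ)     = ex (renameSyms φ)

  module _ (M : Structure τ) (I : (e′ : E′) → RelOn (Carrier M) (ear′ e′)) where
    private
      M⁺ = expandStr M E (ear′ ∘ h) (λ e → I (h e))
      M′ = expandStr M E′ ear′ I

    evalT-retagT : (t : Term σ m) (s : Vec (Carrier M) m) → evalT M′ (retagT t) s ≡ evalT M⁺ t s
    evalT-retagT t s = trans (evalT-expandT M I {ρ = id} {s} {s} (λ _ → refl) (reductT id t))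
                             (evalT-reductT M (λ e → I (h e)) {ρ = id} {s} {s} (λ _ → refl) t)

    evalTs-retagTs : (ts : Vec (Term σ m) k) (s : Vec (Carrier M) m)
                   → evalTs M′ (retagTs ts) s ≡ evalTs M⁺ ts s
    evalTs-retagTs ts s =
      trans (evalTs-expandTs M I {ρ = id} {s} {s} (λ _ → refl) (reductTs id ts))
            (evalTs-reductTs M (λ e → I (h e)) {ρ = id} {s} {s} (λ _ → refl) ts)

    Sat-renameSyms : (φ : FO σ m) (s : Vec (Carrier M) m) → Sat M⁺ φ s ⇔ Sat M′ (renameSyms φ) s
    Sat-renameSyms (rel (inj₁ r) ts) s = subst-⇔ (relI M r) (sym (evalTs-retagTs ts s))
    Sat-renameSyms (rel (inj₂ e) ts) s = subst-⇔ (I (h e)) (sym (evalTs-retagTs ts s))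
    Sat-renameSyms (eq t u)   s = ≡-⇔ (sym (evalT-retagT t s)) (sym (evalT-retagT u s))
    Sat-renameSyms (neg φ)    s = ¬-⇔ (Sat-renameSyms φ s)
    Sat-renameSyms (conj φ ψ) s = Sat-renameSyms φ s ×-⇔ Sat-renameSyms ψ s
    Sat-renameSyms (disj φ ψ) s = Sat-renameSyms φ s ⊎-⇔ Sat-renameSyms ψ s
    Sat-renameSyms (all φ)    s = Π-⇔ λ a → Sat-renameSyms φ (a ∷ s)
    Sat-renameSyms (ex φ)     s = Σ-⇔ λ a → Sat-renameSyms φ (a ∷ s)

three⇒two : {τ : Sig} {A B : Structure τ} (f : PartialTeamMap A B)
          → InducedIsPartialElementary f → PreservesSOParams f
three⇒two {A = A} {B} f induced n ar φ X p _ = begin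
  Sat (expandStr A _ _ (λ i → X (lower i))) φ []
    ⇔⟨ Sat-renameSyms symbol A (λ { (_ , X , _) → X }) φ [] ⟩
  Sat (Â f) (renameSyms symbol φ) []
    ⇔⟨ induced 0 (renameSyms symbol φ) [] [] [] ⟩
  Sat (B̂ f) (renameSyms symbol φ) []
    ⇔˘⟨ Sat-renameSyms symbol B (λ { (n , X , p) → app f n X p }) φ [] ⟩
  Sat (expandStr B _ _ (λ i → app f (ar (lower i)) (X (lower i)) (p (lower i)))) φ []
    ∎
  where
  open ⇔-Reasoning
  symbol : Lift (lsuc lzero) (Fin n) → DomSym f
  symbol (lift i) = ar i , X i , p i

fin3 : {F : Fin 3 → Set ℓ} → F zero → F (suc zero) → F (suc (suc zero)) → ∀ i → F i
fin3 x y z zero             = x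
fin3 x y z (suc zero)       = y
fin3 x y z (suc (suc zero)) = z

productArities : ℕ → ℕ → Fin 3 → ℕ
productArities m k = fin3 m k (m + k)

module ProductSentence {τ : Sig} (m k : ℕ) where
  private
    σ₃ = expandSig τ (Lift (lsuc lzero) (Fin 3)) (λ i → productArities m k (lower i))
    Zat = rel {σ₃} (inj₂ (lift (suc (suc zero)))) (vars (firsts (m + k) 0))
    Xat = rel {σ₃} (inj₂ (lift zero)) (vars (map (_↑ˡ 0) (firsts m k)))
    Yat = rel {σ₃} (inj₂ (lift (suc zero))) (vars (map (_↑ˡ 0) (lasts m k)))

  productSentence : FO σ₃ 0
  productSentence = ∀ⁿ (m + k) (Zat ⇔F conj Xat Yat)

  Sat-productSentence : ExcludedMiddle (lsuc lzero) → (M : Structure τ)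
                        (I : (i : Fin 3) → RelOn (Carrier M) (productArities m k i))
                      → Sat (expandStr M _ _ (λ i → I (lower i))) productSentence []
                        ⇔ (I (suc (suc zero)) ≐ (I zero ⊗ I (suc zero)))
  Sat-productSentence lem M I = begin
    Sat M₃ productSentence []
      ⇔⟨ Sat-∀ⁿ M₃ (m + k) _ [] ⟩
    (∀ v → Sat M₃ (Zat ⇔F conj Xat Yat) (v ++ []))
      ⇔⟨ Π-⇔ (λ v → Sat-⇔F M₃ lem Zat (conj Xat Yat) (v ++ [])) ⟩
    (∀ v → Sat M₃ Zat (v ++ []) ⇔ (Sat M₃ Xat (v ++ []) × Sat M₃ Yat (v ++ [])))
      ⇔⟨ Π-⇔ (λ v → ⇔-⇔ (Z-value v) (X-value v ×-⇔ Y-value v)) ⟩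
    (∀ v → Z v ⇔ (X (take m v) × Y (drop m v)))
      ∎
    where
    open ⇔-Reasoning
    M₃ = expandStr M _ _ (λ i → I (lower i))
    X = I zero
    Y = I (suc zero)
    Z = I (suc (suc zero))
    value : (v : Vec (Carrier M) (m + k)) {j : ℕ} (is : Vec (Fin ((m + k) + 0)) j) {w : Vec (Carrier M) j}
          → map (lookup (v ++ [])) is ≡ w → evalTs M₃ (vars is) (v ++ []) ≡ w
    value v is = trans (evalTs-vars M₃ is (v ++ []))
    Z-value : ∀ v → Sat M₃ Zat (v ++ []) ⇔ Z v
    Z-value v = subst-⇔ Z (value v _ (map-lookup-firsts v []))
    X-value : ∀ v → Sat M₃ Xat (v ++ []) ⇔ X (take m v)
    X-value v = subst-⇔ X (value v _ (trans (map-lookup-↑ˡ v [] _) (map-lookup-firsts-take v)))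
    Y-value : ∀ v → Sat M₃ Yat (v ++ []) ⇔ Y (drop m v)
    Y-value v = subst-⇔ Y (value v _ (trans (map-lookup-↑ˡ v [] _) (map-lookup-lasts-drop v)))

module FromSentences {τ : Sig} {A B : Structure τ} (f : PartialTeamMap A B)
                     (lem : ExcludedMiddle (lsuc lzero)) (pres : PreservesSOParams f) where

  module OneParam (m : ℕ) = TeamAsSymbol {τ} {Lift (lsuc lzero) (Fin 1)} {λ _ → m} (lift zero)

  pres₁ : (X : RelOn (Carrier A) m) (p : Dom f m X) → NonEmpty X
        → (φ : FO (expandSig τ (Lift (lsuc lzero) (Fin 1)) (λ _ → m)) 0)
        → Sat (expandStr A _ _ (λ _ → X)) φ [] ⇔ Sat (expandStr B _ _ (λ _ → app f m X p)) φ []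
  pres₁ {m} X p ne φ = pres 1 (λ _ → m) φ (λ _ → X) (λ _ → p) (λ _ → ne)

  Sat-nonemptiness : (M : Structure τ) (X : RelOn (Carrier M) m)
                   → Sat (expandStr M _ _ (λ _ → X)) (OneParam.∃∈ m ⊤F) [] ⇔ NonEmpty X
  Sat-nonemptiness {m} M X = ⇔-trans (OneParam.Sat-∃∈ m lem M (λ _ → X) ⊤F [])
    ((λ (xs , x , _) → xs , x) , (λ (xs , x) → xs , x , λ _ → refl))

  nonempty-preserved : (X : RelOn (Carrier A) m) (p : Dom f m X) → NonEmpty X → NonEmpty (app f m X p)
  nonempty-preserved {m} X p ne =
    proj₁ (Sat-nonemptiness B _)
      (proj₁ (pres₁ X p ne (OneParam.∃∈ m ⊤F)) (proj₂ (Sat-nonemptiness A X) ne))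

  -- ∅ = f(W) for some W ∈ dom(f), and W must be empty since f preserves nonemptiness.
  empty-preserved : (X : RelOn (Carrier A) m) (p : Dom f m X) → Empty X → Empty (app f m X p)
  empty-preserved {m} X p EX with Closed.c-empty (rng-closed f) m
  ... | W , pW , fW≐∅ with nonempty-or-empty lem W
  ...   | inj₁ neW = ⊥-elim (proj₁ (fW≐∅ v) w)
    where
    v = proj₁ (nonempty-preserved W pW neW)
    w = proj₂ (nonempty-preserved W pW neW)
  ...   | inj₂ EW = λ v x → proj₁ (fW≐∅ v) (proj₁ (app-wd f m X W p pW (empty-≐ EX EW) v) x)

  carrier-maps : (Carrier A → Carrier B) × (Carrier B → Carrier A)
  carrier-maps =
      (λ a → proj₁ (proj₁ (pres 0 (λ ()) inhabited (λ ()) (λ ()) (λ ())) (a , refl)))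
    , (λ b → proj₁ (proj₂ (pres 0 (λ ()) inhabited (λ ()) (λ ()) (λ ())) (b , refl)))
    where
    inhabited : {σ : Sig} → FO σ 0
    inhabited = ex (eq (var zero) (var zero))

  fot-preserved : ∀ n (φ : FOT τ n) (X : RelOn (Carrier A) n) (p : Dom f n X)
                → TSat A X φ ⇔ TSat B (app f n X p) φ
  fot-preserved n φ X p with nonempty-or-empty lem X
  ... | inj₁ ne = begin
    TSat A X φ
      ⇔⟨ OneParam.Sat-toFO n lem A (λ _ → X) φ [] ⟩
    Sat (expandStr A _ _ (λ _ → X)) (OneParam.toFO n φ) []
      ⇔⟨ pres₁ X p ne (OneParam.toFO n φ) ⟩
    Sat (expandStr B _ _ (λ _ → app f n X p)) (OneParam.toFO n φ) []
      ⇔˘⟨ OneParam.Sat-toFO n lem B (λ _ → app f n X p) φ [] ⟩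
    TSat B (app f n X p) φ
      ∎
    where open ⇔-Reasoning
  ... | inj₂ EX = TSat-empty-transfer A B toB toA φ (empty-preserved X p EX)
                , TSat-empty-transfer B A toA toB φ EX
    where
    toB = proj₁ carrier-maps
    toA = proj₂ carrier-maps

  ⊗-preserved : ∀ m k (X : RelOn (Carrier A) m) (Y : RelOn (Carrier A) k)
                (p : Dom f m X) (q : Dom f k Y) (r : Dom f (m + k) (X ⊗ Y))
              → app f (m + k) (X ⊗ Y) r ≐ (app f m X p ⊗ app f k Y q)
  ⊗-preserved m k X Y p q r with nonempty-or-empty lem X | nonempty-or-empty lem Y
  ... | inj₁ neX | inj₁ neY =
    proj₁ (Sat-productSentence lem B (λ i → app f _ (XYZ i) (pqr i)))
      (proj₁ (pres 3 (productArities m k) productSentence XYZ pqr (fin3 neX neY (⊗-nonempty X Y neX neY)))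
             (proj₂ (Sat-productSentence lem A XYZ) (≐-refl (X ⊗ Y))))
    where
    open ProductSentence {τ} m k
    XYZ : (i : Fin 3) → RelOn (Carrier A) (productArities m k i)
    XYZ = fin3 X Y (X ⊗ Y)
    pqr : (i : Fin 3) → Dom f (productArities m k i) (XYZ i)
    pqr = fin3 p q r
  ... | inj₂ EX | _ = empty-≐ (empty-preserved _ r (⊗-empty X Y (inj₁ EX)))
                             (⊗-empty (app f m X p) (app f k Y q) (inj₁ (empty-preserved X p EX)))
  ... | inj₁ _ | inj₂ EY = empty-≐ (empty-preserved _ r (⊗-empty X Y (inj₂ EY)))
                                  (⊗-empty (app f m X p) (app f k Y q) (inj₂ (empty-preserved Y q EY)))

  two⇒one : IsElementaryTeamMap f
  two⇒one = ⊗-preserved , fot-preserved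

module FromTeamElementarity {τ : Sig} {A B : Structure τ} (f : PartialTeamMap A B)
                            (lem : ExcludedMiddle (lsuc lzero)) (elem : IsElementaryTeamMap f) where
  private
    ⊗-pres = proj₁ elem
    fot-pres = proj₂ elem
    open Closed (dom-closed f) using (c-full; c-prod)

  empty-preserved : (X : RelOn (Carrier A) n) (p : Dom f n X) → Empty X → Empty (app f n X p)
  empty-preserved {n} X p EX =
    proj₁ (TSat-falseᵀ B _) (proj₁ (fot-pres n falseᵀ X p) (proj₂ (TSat-falseᵀ A X) EX))

  nonempty-preserved : (X : RelOn (Carrier A) n) (p : Dom f n X) → NonEmpty X → NonEmpty (app f n X p)
  nonempty-preserved {n} X p (v , x) with nonempty-or-empty lem (app f n X p)
  ... | inj₁ ne = ne
  ... | inj₂ E =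
    ⊥-elim (proj₁ (TSat-falseᵀ A X) (proj₂ (fot-pres n falseᵀ X p) (proj₂ (TSat-falseᵀ B _) E)) v x)

  occupied-preserved : (b : Bool) (X : RelOn (Carrier A) n) (p : Dom f n X)
                     → Occupied b X → Occupied b (app f n X p)
  occupied-preserved true  = nonempty-preserved
  occupied-preserved false = empty-preserved

  full⁰-preserved : (p : Dom f 0 (fullᴿ 0)) → app f 0 (fullᴿ 0) p ≐ fullᴿ 0
  full⁰-preserved p [] = (λ _ → tt) , (λ _ → witness (nonempty-preserved (fullᴿ 0) p ([] , tt)))
    where
    witness : NonEmpty (app f 0 (fullᴿ 0) p) → app f 0 (fullᴿ 0) p []
    witness ([] , y) = y

  IA : (e : DomSym f) → RelOn (Carrier A) (proj₁ e)
  IA (_ , X , _) = X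

  IB : (e : DomSym f) → RelOn (Carrier B) (proj₁ e)
  IB (n , X , p) = app f n X p

  status : (e : DomSym f) → Σ Bool λ b → Occupied b (IA e)
  status (_ , X , _) with nonempty-or-empty lem X
  ... | inj₁ ne = true , ne
  ... | inj₂ E  = false , E

  occupied : DomSym f → Bool
  occupied e = proj₁ (status e)

  occupiedA : ∀ e → Occupied (occupied e) (IA e)
  occupiedA e = proj₂ (status e)

  occupiedB : ∀ e → Occupied (occupied e) (IB e)
  occupiedB e@(_ , X , p) = occupied-preserved (occupied e) X p (occupiedA e)

  open ParamsAsTeam {τ} {DomSym f} {proj₁} occupied

  occurrencesA : (φ : FO (expandSig τ (DomSym f) proj₁) k) → RelOn (Carrier A) (occArity φ)
  occurrencesA = occurrences A IA occupiedA

  occurrencesB : (φ : FO (expandSig τ (DomSym f) proj₁) k) → RelOn (Carrier B) (occArity φ)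
  occurrencesB = occurrences B IB occupiedB

  slot-dom : (b : Bool) (e : DomSym f) → Dom f (slotArity b (proj₁ e)) (slot b (IA e))
  slot-dom true  (_ , _ , p) = p
  slot-dom false _           = c-full 0

  slot-image : (b : Bool) (e : DomSym f) (p : Dom f (slotArity b (proj₁ e)) (slot b (IA e)))
             → app f _ (slot b (IA e)) p ≐ slot b (IB e)
  slot-image true  (n , X , q) p = app-wd f n X X p q (≐-refl X)
  slot-image false _           p = full⁰-preserved p

  occurrences-dom : (φ : FO (expandSig τ (DomSym f) proj₁) k) → Dom f (occArity φ) (occurrencesA φ)
  occurrences-dom (rel (inj₁ r) ts) = c-full 0
  occurrences-dom (rel (inj₂ e) ts) = slot-dom (occupied e) e
  occurrences-dom (eq t u)          = c-full 0
  occurrences-dom (neg φ)           = occurrences-dom φ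
  occurrences-dom (conj φ ψ)        = c-prod _ _ _ _ (occurrences-dom φ) (occurrences-dom ψ)
  occurrences-dom (disj φ ψ)        = c-prod _ _ _ _ (occurrences-dom φ) (occurrences-dom ψ)
  occurrences-dom (all φ)           = occurrences-dom φ
  occurrences-dom (ex φ)            = occurrences-dom φ

  ⊗-occurrences-image : (φ ψ : FO (expandSig τ (DomSym f) proj₁) k)
                        (p : Dom f (occArity φ + occArity ψ) (occurrencesA φ ⊗ occurrencesA ψ))
                      → app f _ (occurrencesA φ ⊗ occurrencesA ψ) p ≐ (occurrencesB φ ⊗ occurrencesB ψ)

  occurrences-image : (φ : FO (expandSig τ (DomSym f) proj₁) k) (p : Dom f (occArity φ) (occurrencesA φ))
                    → app f _ (occurrencesA φ) p ≐ occurrencesB φ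
  occurrences-image (rel (inj₁ r) ts) p = full⁰-preserved p
  occurrences-image (rel (inj₂ e) ts) p = slot-image (occupied e) e p
  occurrences-image (eq t u)          p = full⁰-preserved p
  occurrences-image (neg φ)           p = occurrences-image φ p
  occurrences-image (conj φ ψ)        p = ⊗-occurrences-image φ ψ p
  occurrences-image (disj φ ψ)        p = ⊗-occurrences-image φ ψ p
  occurrences-image (all φ)           p = occurrences-image φ p
  occurrences-image (ex φ)            p = occurrences-image φ p

  ⊗-occurrences-image φ ψ p = ≐-trans (⊗-pres _ _ _ _ (occurrences-dom φ) (occurrences-dom ψ) p)
                                       (⊗-cong (occurrences-image φ _) (occurrences-image ψ _))

  tupleᴿ-image : (as : Vec (Carrier A) k) (bs : Vec (Carrier B) k) → Pointwise (PointMap f) as bs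
               → Σ[ p ∈ Dom f k (tupleᴿ as) ] (app f k (tupleᴿ as) p ≐ tupleᴿ bs)
  tupleᴿ-image []       []       []                  = c-full 0 , full⁰-preserved _
  tupleᴿ-image (a ∷ as) (b ∷ bs) ((pa , fa≐b) ∷ as↦bs) with tupleᴿ-image as bs as↦bs
  ... | p , fas≐bs = c-prod 1 _ _ _ pa p
                   , ≐-trans (⊗-pres 1 _ _ _ pa p _) (⊗-cong fa≐b fas≐bs)

  one⇒three : InducedIsPartialElementary f
  one⇒three k φ as bs as↦bs = begin
    Sat (Â f) φ as
      ⇔˘⟨ TSat-toFOT A IA occupiedA φ (allFin w) RA (Pr-allFin RA) as ⟩
    TSat A (prefixed as RA) ψ
      ⇔˘⟨ TSat-≐ A ψ (tupleᴿ-⊗ as RA) ⟩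
    TSat A (tupleᴿ as ⊗ RA) ψ
      ⇔⟨ fot-pres (k + w) ψ _ p ⟩
    TSat B (app f (k + w) (tupleᴿ as ⊗ RA) p) ψ
      ⇔⟨ TSat-≐ B ψ image ⟩
    TSat B (prefixed bs RB) ψ
      ⇔⟨ TSat-toFOT B IB occupiedB φ (allFin w) RB (Pr-allFin RB) bs ⟩
    Sat (B̂ f) φ bs
      ∎
    where
    open ⇔-Reasoning
    w = occArity φ
    ψ = toFOT φ (allFin w)
    RA = occurrencesA φ
    RB = occurrencesB φ
    pas = proj₁ (tupleᴿ-image as bs as↦bs)
    p = c-prod k w _ _ pas (occurrences-dom φ)
    image : app f (k + w) (tupleᴿ as ⊗ RA) p ≐ prefixed bs RB
    image = ≐-trans (⊗-pres k w _ _ pas (occurrences-dom φ) p)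
              (≐-trans (⊗-cong (proj₂ (tupleᴿ-image as bs as↦bs)) (occurrences-image φ _))
                       (tupleᴿ-⊗ bs RB))

mainTheorem12 : {τ : Sig} (A B : Structure τ) (f : PartialTeamMap A B)
    → ExcludedMiddle (lsuc lzero)
    → (IsElementaryTeamMap f ⇔ PreservesSOParams f)
      × (IsElementaryTeamMap f ⇔ InducedIsPartialElementary f)
mainTheorem12 A B f lem = (one⇒two , two⇒one) , (one⇒three , two⇒one ∘ three⇒two f)
  where
  open FromSentences f lem using (two⇒one)
  one⇒three : IsElementaryTeamMap f → InducedIsPartialElementary f
  one⇒three elem = FromTeamElementarity.one⇒three f lem elem
  one⇒two : IsElementaryTeamMap f → PreservesSOParams f
  one⇒two = three⇒two f ∘ one⇒three
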